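{- For any common suffix trie $\mathcal{T}$ such that $\mathrm{pCST}(\mathcal{T})$ has $N_p$ nodes, $\mathrm{PPH}(\mathcal{T})$ consists of exactly $N_p$ nodes, and there is a one-to-one correspondence between the nodes of $\mathrm{pCST}(\mathcal{T})$ and the nodes of $\mathrm{PPH}(\mathcal{T})$ (the node of $\mathrm{pCST}(\mathcal{T})$ representing $w_i$ corresponding to the node inserted at step $i$ of the construction of $\mathrm{PPH}(\mathcal{T})$).
   Context: $\Sigma$ and $\Pi$ are disjoint finite ordered alphabets; $\Sigma \cup \Pi$ carries a fixed total order and strings are compared lexicographically. A p-string is a string over $\Sigma \cup \Pi$; $w^R$ is the reversal of $w$. Two p-strings $x,y$ of equal length $k$ p-match iff some bijection $f$ on $\Sigma\cup\Pi$ fixing every element of $\Sigma$ satisfies $f(x[i]) = y[i]$ for all $i$. $\mathrm{spe}(x)$ is the lexicographically smallest p-string p-matching $x$. A common suffix trie (CS trie) is a rooted tree with edges directed towards the root, labeled by characters of $\Sigma\cup\Pi$, with mutually distinct labels on the in-coming edges of each node; each node represents the concatenation of labels on its path to the root. For a CS trie $\mathcal{T}$ with set $W_{\mathcal{T}}$ of represented p-strings, $\mathrm{pcs}(\mathcal{T}) = \{\mathrm{spe}(w^R)^R : w \in W_{\mathcal{T}}\}$ and $\mathrm{pCST}(\mathcal{T})$ is the CS trie whose nodes represent exactly the p-strings of $\mathrm{pcs}(\mathcal{T})$. Enumerate $\mathrm{pcs}(\mathcal{T}) = \{w_1,\ldots,w_{N_p}\}$ with $|w_i| \le |w_{i+1}|$.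 The sequence hash tree $\mathrm{SHT}(\langle s_1,\ldots,s_k\rangle)$ (for a sequence in which no $s_i$ is a prefix of an earlier $s_j$) is the trie (nodes identified with the strings spelled from the root) defined by: $\mathrm{SHT}^1$ has only the root $\varepsilon$; for $2\le i\le k$, $\mathrm{SHT}^i$ is $\mathrm{SHT}^{i-1}$ plus the node $u_i$ and edge $(v_i, s_i[|v_i|+1], u_i)$, where $v_i$ is the longest prefix of $s_i$ that is a node of $\mathrm{SHT}^{i-1}$ and $u_i$ is the shortest prefix of $s_i$ that is not. $\mathrm{PPH}(\mathcal{T}) = \mathrm{SHT}(\langle \mathrm{spe}(w_1),\ldots,\mathrm{spe}(w_{N_p})\rangle)$. -}

module Defs where

open import Data.Nat using (ℕ; zero; suc; _+_; _≤_; _<_)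
open import Data.Fin as Fin using (Fin; toℕ)
open import Data.Bool using (Bool; true; false)
open import Data.List using (List; []; _∷_; _++_; _∷ʳ_; map; length; reverse; inits; lookup)
open import Data.List.Properties using (≡-dec)
open import Data.List.Membership.Propositional using (_∈_)
open import Data.List.Membership.DecPropositional using () renaming (_∈?_ to ∈?-gen)
open import Data.List.Relation.Unary.Unique.Propositional using (Unique)
open import Data.Maybe using (Maybe; just; nothing)
open import Data.Product using (Σ; _×_; _,_; proj₁; ∃)
open import Relation.Binary.PropositionalEquality using (_≡_)
open import Relation.Nullary using (¬_; yes; no; Dec)
open import Data.Unit using (⊤)
open import Function.Bundles using (_↔_; Inverse)

-- The alphabet Σ ∪ Π is modelled as Fin n with its natural total order
-- (every finite total order is isomorphic to such a one).  The predicate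
-- inΣ singles out Σ; characters with inΣ a ≡ false form Π (so Σ and Π are
-- disjoint and cover the alphabet).
module _ (n : ℕ) (inΣ : Fin n → Bool) where

  PStr : Set
  PStr = List (Fin n)

  PMatch : PStr → PStr → Set
  PMatch x y = Σ (Fin n ↔ Fin n) λ f →
    (∀ a → inΣ a ≡ true → Inverse.to f a ≡ a) × (map (Inverse.to f) x ≡ y)

  data _≤lex_ : PStr → PStr → Set where
    []≤    : ∀ {ys} → [] ≤lex ys
    <≤     : ∀ {x y xs ys} → x Fin.< y → (x ∷ xs) ≤lex (y ∷ ys)
    ≡≤     : ∀ {x xs ys} → xs ≤lex ys → (x ∷ xs) ≤lex (x ∷ ys)

  IsSpe : (PStr → PStr) → Set
  IsSpe spe = ∀ x → PMatch x (spe x) × (∀ y → PMatch x y → spe x ≤lex y)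

-- Common suffix tries: rose trees, each child hangs on an edge (directed
-- towards the root = the parent) labelled by a character.
data CST (n : ℕ) : Set where
  node : List (Fin n × CST n) → CST n

module _ {n : ℕ} where

  -- strings represented by the nodes of a CS trie (one entry per node):
  -- a node represents the labels read on its path up to the root.
  mutual
    W : CST n → List (List (Fin n))
    W (node ks) = [] ∷ Wk ks

    Wk : List (Fin n × CST n) → List (List (Fin n))
    Wk [] = []
    Wk ((c , t) ∷ ks) = map (_∷ʳ c) (W t) ++ Wk ks

  mutual
    ValidCST : CST n → Set
    ValidCST (node ks) = Unique (map proj₁ ks) × ValidKids ks

    ValidKids : List (Fin n × CST n) → Set
    ValidKids [] = ⊤
    ValidKids ((c , t) ∷ ks) = ValidCST t × ValidKids ks

  mutual
    nodeCount : CST n → ℕ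
    nodeCount (node ks) = suc (countKids ks)

    countKids : List (Fin n × CST n) → ℕ
    countKids [] = 0
    countKids ((c , t) ∷ ks) = nodeCount t + countKids ks

  -- pcs(T) = { spe(w^R)^R : w ∈ W_T } (as a list, possibly with repetitions)
  pcs : (List (Fin n) → List (Fin n)) → CST n → List (List (Fin n))
  pcs spe T = map (λ w → reverse (spe (reverse w))) (W T)

  Prefix : List (Fin n) → List (Fin n) → Set
  Prefix xs ys = ∃ λ zs → xs ++ zs ≡ ys

  NoPrefixEarlier : List (List (Fin n)) → Set
  NoPrefixEarlier ss = ∀ (i j : Fin (length ss)) → toℕ j < toℕ i →
    ¬ Prefix (lookup ss i) (lookup ss j)

  private
    _∈?_ : (x : List (Fin n)) (N : List (List (Fin n))) → Dec (x ∈ N)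
    _∈?_ = ∈?-gen (≡-dec Fin._≟_)

  firstNotIn : List (List (Fin n)) → List (List (Fin n)) → Maybe (List (Fin n))
  firstNotIn N [] = nothing
  firstNotIn N (p ∷ ps) with p ∈? N
  ... | yes _ = firstNotIn N ps
  ... | no  _ = just p

  -- A trie whose nodes are identified with the strings
  -- spelled from the root is represented by its list of nodes, in insertion
  -- order (edges are implicit: u_i = v_i · s_i[|v_i|+1] is a child of v_i).
  -- Step i ≥ 2 inserts u_i, the shortest prefix of s_i that is not yet a
  -- node; if it does not exist, SHT is undefined (nothing).
  shtSteps : List (List (Fin n)) → List (List (Fin n)) → Maybe (List (List (Fin n)))
  shtSteps N [] = just N
  shtSteps N (s ∷ ss) with firstNotIn N (inits s)
  ... | nothing = nothing
  ... | just u  = shtSteps (N ∷ʳ u) ss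

  SHT : List (List (Fin n)) → Maybe (List (List (Fin n)))
  SHT [] = nothing
  SHT (s₁ ∷ ss) = shtSteps ([] ∷ []) ss

-- Canonical forms separate p-matching classes, so distinct elements of pcs(T) have distinct
-- spe-images of length |w_i|.  Sorted by length, a later spe(w_i) could only be a prefix of
-- an earlier spe(w_j) if the two had equal length, i.e. were equal, which is impossible.
-- Hence each s_i is not yet a node when it is inserted, every step of the sequence hash tree
-- adds exactly one new node, and PPH(T) has one node per element of pcs(T) = W(pCST(T)).
module Submission where

open import Defs
open import Data.Nat using (ℕ; suc; _+_; _≤_; _<_; s≤s)
open import Data.Nat.Properties using (≤-trans; +-identityʳ; +-assoc)
open import Data.Fin as Fin using (Fin; toℕ)
open import Data.Fin.Properties using (<-asym; <-irrefl)
open import Data.Bool using (Bool)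
open import Data.List using (List; []; _∷_; _++_; _∷ʳ_; map; length; reverse; inits; lookup)
open import Data.List.Properties
  using (≡-dec; length-map; length-++; map-∘; map-cong; map-id; ++-assoc; ++-identityʳ;
         reverse-map; reverse-involutive; ∷ʳ-injective)
open import Data.List.Membership.Propositional using (_∈_; _∉_)
open import Data.List.Membership.Propositional.Properties using (∈-map⁻; ∈-map⁺; ∈-++⁻; ∈-lookup)
open import Data.List.Membership.Propositional.Properties.WithK using (unique∧set⇒bag)
open import Data.List.Membership.DecPropositional using () renaming (_∈?_ to ∈?-gen)
open import Data.List.Relation.Binary.BagAndSetEquality using (∼bag⇒↭)
open import Data.List.Relation.Binary.Permutation.Propositional.Properties using (↭-length)
open import Data.List.Relation.Unary.Any using (here; there)
open import Data.List.Relation.Unary.All as All using (All; []; _∷_)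
open import Data.List.Relation.Unary.AllPairs as AllPairs using (AllPairs; []; _∷_)
import Data.List.Relation.Unary.AllPairs.Properties as AllPairs
open import Data.List.Relation.Unary.Linked using (Linked)
open import Data.List.Relation.Unary.Linked.Properties using (Linked⇒AllPairs)
open import Data.List.Relation.Unary.Unique.Propositional using (Unique)
import Data.List.Relation.Unary.Unique.Propositional.Properties as Unique
open import Data.Maybe using (just)
open import Data.Product using (Σ; _×_; _,_; proj₁; proj₂; ∃)
open import Data.Sum using (inj₁; inj₂)
open import Data.Empty using (⊥; ⊥-elim)
open import Function using (_∘_; id)
open import Function.Bundles using (_⇔_; Inverse; Equivalence)
open import Function.Construct.Symmetry using (↔-sym; ⇔-sym)
open import Function.Construct.Composition using (_↔-∘_; _⇔-∘_)
open import Relation.Binary.PropositionalEquality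
  using (_≡_; refl; sym; trans; cong; cong₂; subst₂; _≢_; module ≡-Reasoning)
open import Relation.Nullary using (¬_; yes; no)

module _ {A : Set} where

  AllPairs-lookup : ∀ {R : A → A → Set} {xs : List A} → AllPairs R xs →
    (i j : Fin (length xs)) → toℕ j < toℕ i → R (lookup xs j) (lookup xs i)
  AllPairs-lookup (rx ∷ rxs) (Fin.suc i) Fin.zero    _         = All.lookup rx (∈-lookup i)
  AllPairs-lookup (rx ∷ rxs) (Fin.suc i) (Fin.suc j) (s≤s j<i) = AllPairs-lookup rxs i j j<i

  AllPairs-map-within : ∀ {P : A → Set} {R S : A → A → Set} →
    (∀ {x y} → P x → P y → R x y → S x y) →
    ∀ {xs} → All P xs → AllPairs R xs → AllPairs S xs
  AllPairs-map-within f []         []         = []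
  AllPairs-map-within f (px ∷ pxs) (rx ∷ rxs) =
    All.zipWith (λ (py , rxy) → f px py rxy) (pxs , rx) ∷ AllPairs-map-within f pxs rxs

  Unique-∷ʳ : ∀ {xs : List A} {x} → Unique xs → x ∉ xs → Unique (xs ∷ʳ x)
  Unique-∷ʳ xs! x∉xs = Unique.++⁺ xs! ([] ∷ []) λ { (x∈xs , here refl) → x∉xs x∈xs }

  unique-set-equal⇒length≡ : ∀ {xs ys : List A} → Unique xs → Unique ys →
    (∀ {x} → (x ∈ xs) ⇔ (x ∈ ys)) → length xs ≡ length ys
  unique-set-equal⇒length≡ xs! ys! xs⇔ys = ↭-length (∼bag⇒↭ (unique∧set⇒bag xs! ys! xs⇔ys))

module _ {n : ℕ} where

  private
    Str : Set
    Str = List (Fin n)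

  Prefix-trans : ∀ {a b c : Str} → Prefix a b → Prefix b c → Prefix a c
  Prefix-trans {a} (zs , a++zs≡b) (ys , b++ys≡c) =
    zs ++ ys , trans (sym (++-assoc a zs ys)) (trans (cong (_++ ys) a++zs≡b) b++ys≡c)

  Prefix-of-shorter⇒≡ : ∀ {a b : Str} → Prefix a b → length b ≤ length a → a ≡ b
  Prefix-of-shorter⇒≡ {[]}    ([]    , refl) _         = refl
  Prefix-of-shorter⇒≡ {x ∷ a} (zs , refl)      (s≤s le) =
    cong (x ∷_) (Prefix-of-shorter⇒≡ (zs , refl) le)

  ∈-inits : ∀ (s : Str) → s ∈ inits s
  ∈-inits []      = here refl
  ∈-inits (x ∷ s) = there (∈-map⁺ (x ∷_) (∈-inits s))

  ∈-inits⇒Prefix : ∀ (s : Str) {u} → u ∈ inits s → Prefix u s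
  ∈-inits⇒Prefix s       (here refl) = s , refl
  ∈-inits⇒Prefix (x ∷ s) (there u∈)  with ∈-map⁻ (x ∷_) u∈
  ... | v , v∈ , refl with ∈-inits⇒Prefix s v∈
  ...   | zs , v++zs≡s = zs , cong (x ∷_) v++zs≡s

  -- The decision procedure used by firstNotIn is private to Defs; the term below is the same one,
  -- so the with-abstraction unblocks firstNotIn.
  firstNotIn-just : ∀ (N ps : List Str) {p} → p ∈ ps → p ∉ N →
    ∃ λ u → firstNotIn N ps ≡ just u × u ∈ ps × u ∉ N
  firstNotIn-just N (q ∷ ps) p∈ p∉N with ∈?-gen (≡-dec Fin._≟_) q N
  ... | no q∉N = q , refl , here refl , q∉N
  ... | yes q∈N with p∈
  ...   | here refl = ⊥-elim (p∉N q∈N)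
  ...   | there p∈ps with firstNotIn-just N ps p∈ps p∉N
  ...     | u , eq , u∈ , u∉N = u , eq , there u∈ , u∉N

  Fresh : List Str → Str → Set
  Fresh N s = ∀ {u} → u ∈ N → ¬ Prefix s u

  Fresh-∷ʳ : ∀ {N : List Str} {u s t} → Prefix u s → Fresh N t × ¬ Prefix t s → Fresh (N ∷ʳ u) t
  Fresh-∷ʳ {N} u⊑s (t-fresh , t⋢s) v∈ with ∈-++⁻ N v∈
  ... | inj₁ v∈N         = t-fresh v∈N
  ... | inj₂ (here refl) = λ t⊑u → t⋢s (Prefix-trans t⊑u u⊑s)

  shtSteps-just : ∀ (N ss : List Str) → Unique N → All (Fresh N) ss →
    AllPairs (λ s t → ¬ Prefix t s) ss →
    ∃ λ nodes → shtSteps N ss ≡ just nodes × length nodes ≡ length N + length ss × Unique nodes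
  shtSteps-just N [] N! _ _ = N , refl , sym (+-identityʳ (length N)) , N!
  shtSteps-just N (s ∷ ss) N! (s-fresh ∷ ss-fresh) (s⋢ss ∷ ss⋢ss)
    with firstNotIn-just N (inits s) (∈-inits s) (λ s∈N → s-fresh s∈N ([] , ++-identityʳ s))
  ... | u , first≡u , u∈ , u∉N rewrite first≡u
    with shtSteps-just (N ∷ʳ u) ss (Unique-∷ʳ N! u∉N)
           (All.zipWith (Fresh-∷ʳ (∈-inits⇒Prefix s u∈)) (ss-fresh , s⋢ss))
           ss⋢ss
  ... | nodes , steps≡ , |nodes|≡ , nodes! =
    nodes , steps≡ ,
    trans |nodes|≡ (trans (cong (_+ length ss) (length-++ N)) (+-assoc (length N) 1 (length ss))) ,
    nodes!

module _ {n : ℕ} where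

  mutual
    nodeCount≡length-W : ∀ (t : CST n) → nodeCount t ≡ length (W t)
    nodeCount≡length-W (node ks) = cong suc (countKids≡length-Wk ks)

    countKids≡length-Wk : ∀ ks → countKids ks ≡ length (Wk ks)
    countKids≡length-Wk [] = refl
    countKids≡length-Wk ((c , t) ∷ ks) = begin
      nodeCount t + countKids ks                        ≡⟨ cong₂ _+_ (nodeCount≡length-W t) (countKids≡length-Wk ks) ⟩
      length (W t) + length (Wk ks)                     ≡⟨ cong (_+ length (Wk ks)) (length-map (_∷ʳ c) (W t)) ⟨
      length (map (_∷ʳ c) (W t)) + length (Wk ks)       ≡⟨ length-++ (map (_∷ʳ c) (W t)) ⟨
      length (map (_∷ʳ c) (W t) ++ Wk ks)               ∎
      where open ≡-Reasoning

  ∈-Wk⇒ends-in-label : ∀ ks {v} → v ∈ Wk ks →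
    ∃ λ (v′ : List (Fin n)) → ∃ λ c → c ∈ map proj₁ ks × v ≡ v′ ∷ʳ c
  ∈-Wk⇒ends-in-label ((c , t) ∷ ks) v∈ with ∈-++⁻ (map (_∷ʳ c) (W t)) v∈
  ... | inj₁ v∈t with ∈-map⁻ (_∷ʳ c) v∈t
  ...   | v′ , _ , eq = v′ , c , here refl , eq
  ∈-Wk⇒ends-in-label ((c , t) ∷ ks) v∈ | inj₂ v∈ks with ∈-Wk⇒ends-in-label ks v∈ks
  ...   | v′ , c′ , c′∈ , eq = v′ , c′ , there c′∈ , eq

  mutual
    W-unique : ∀ (t : CST n) → ValidCST t → Unique (W t)
    W-unique (node ks) (labels! , kids-valid) =
      All.tabulate root-not-in-Wk ∷ Wk-unique ks labels! kids-valid
      where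
        root-not-in-Wk : ∀ {v} → v ∈ Wk ks → [] ≢ v
        root-not-in-Wk v∈ []≡v with ∈-Wk⇒ends-in-label ks v∈ | []≡v
        ... | []    , _ , _ , refl | ()
        ... | _ ∷ _ , _ , _ , refl | ()

    Wk-unique : ∀ ks → Unique (map proj₁ ks) → ValidKids ks → Unique (Wk ks)
    Wk-unique [] _ _ = []
    Wk-unique ((c , t) ∷ ks) (c∉ks ∷ labels!) (t-valid , kids-valid) =
      Unique.++⁺ (Unique.map⁺ (λ {x} {y} eq → proj₁ (∷ʳ-injective x y eq)) (W-unique t t-valid))
                 (Wk-unique ks labels! kids-valid)
                 disjoint
      where
        disjoint : ∀ {v} → v ∈ map (_∷ʳ c) (W t) × v ∈ Wk ks → ⊥
        disjoint (v∈t , v∈ks) with ∈-map⁻ (_∷ʳ c) v∈t | ∈-Wk⇒ends-in-label ks v∈ks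
        ... | v₁ , _ , refl | v₂ , c′ , c′∈ , eq =
          All.lookup c∉ks c′∈ (proj₂ (∷ʳ-injective v₁ v₂ eq))

module PMatching (n : ℕ) (inΣ : Fin n → Bool) where

  private
    Str : Set
    Str = List (Fin n)

    PM : Str → Str → Set
    PM = PMatch n inΣ

  PMatch⇒length≡ : ∀ {x y} → PM x y → length x ≡ length y
  PMatch⇒length≡ {x} (f , _ , fx≡y) = trans (sym (length-map _ x)) (cong length fx≡y)

  PMatch-sym : ∀ {x y} → PM x y → PM y x
  PMatch-sym {x} {y} (f , f-fixes-Σ , fx≡y) = ↔-sym f , from-fixes-Σ , from-y≡x
    where
      open Inverse f
      from-fixes-Σ : ∀ a → inΣ a ≡ Bool.true → from a ≡ a
      from-fixes-Σ a a∈Σ = trans (cong from (sym (f-fixes-Σ a a∈Σ))) (strictlyInverseʳ a)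
      from-y≡x : map from y ≡ x
      from-y≡x = begin
        map from y          ≡⟨ cong (map from) fx≡y ⟨
        map from (map to x) ≡⟨ map-∘ x ⟨
        map (from ∘ to) x   ≡⟨ map-cong strictlyInverseʳ x ⟩
        map id x            ≡⟨ map-id x ⟩
        x                   ∎
        where open ≡-Reasoning

  PMatch-trans : ∀ {x y z} → PM x y → PM y z → PM x z
  PMatch-trans {x} (f , f-fixes-Σ , fx≡y) (g , g-fixes-Σ , gy≡z) =
    g ↔-∘ f ,
    (λ a a∈Σ → trans (cong (Inverse.to g) (f-fixes-Σ a a∈Σ)) (g-fixes-Σ a a∈Σ)) ,
    trans (map-∘ x) (trans (cong (map (Inverse.to g)) fx≡y) gy≡z)

  PMatch-reverse : ∀ {x y} → PM x y → PM (reverse x) (reverse y)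
  PMatch-reverse {x} (f , f-fixes-Σ , fx≡y) =
    f , f-fixes-Σ , trans (reverse-map (Inverse.to f) x) (cong reverse fx≡y)

  ≤lex-antisym : ∀ {x y} → _≤lex_ n inΣ x y → _≤lex_ n inΣ y x → x ≡ y
  ≤lex-antisym []≤     []≤     = refl
  ≤lex-antisym (<≤ p)  (<≤ q)  = ⊥-elim (<-asym p q)
  ≤lex-antisym (<≤ p)  (≡≤ _)  = ⊥-elim (<-irrefl refl p)
  ≤lex-antisym (≡≤ _)  (<≤ q)  = ⊥-elim (<-irrefl refl q)
  ≤lex-antisym (≡≤ p)  (≡≤ q)  = cong (_ ∷_) (≤lex-antisym p q)

  module Canonical (spe : Str → Str) (isSpe : IsSpe n inΣ spe) where

    PMatch-spe : ∀ x → PM x (spe x)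
    PMatch-spe x = proj₁ (isSpe x)

    PMatch⇒spe≡ : ∀ {x y} → PM x y → spe x ≡ spe y
    PMatch⇒spe≡ {x} {y} x~y = ≤lex-antisym
      (proj₂ (isSpe x) (spe y) (PMatch-trans x~y (PMatch-spe y)))
      (proj₂ (isSpe y) (spe x) (PMatch-trans (PMatch-sym x~y) (PMatch-spe x)))

    spe≡⇒PMatch : ∀ {x y} → spe x ≡ spe y → PM x y
    spe≡⇒PMatch {x} {y} eq =
      PMatch-trans (PMatch-spe x) (subst₂ PM (sym eq) refl (PMatch-sym (PMatch-spe y)))

    spe-idempotent : ∀ x → spe (spe x) ≡ spe x
    spe-idempotent x = PMatch⇒spe≡ (PMatch-sym (PMatch-spe x))

    canon : Str → Str
    canon w = reverse (spe (reverse w))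

    canon-idempotent : ∀ w → canon (canon w) ≡ canon w
    canon-idempotent w = cong reverse (trans (cong spe (reverse-involutive _)) (spe-idempotent _))

    PMatch⇒canon≡ : ∀ {x y} → PM x y → canon x ≡ canon y
    PMatch⇒canon≡ x~y = cong reverse (PMatch⇒spe≡ (PMatch-reverse x~y))

    ∈-map-canon⇒fixed : ∀ {ws a} → a ∈ map canon ws → canon a ≡ a
    ∈-map-canon⇒fixed a∈ with ∈-map⁻ canon a∈
    ... | w , _ , refl = canon-idempotent w

    spe-injective-on-canon : ∀ {ws a b} → a ∈ map canon ws → b ∈ map canon ws →
      spe a ≡ spe b → a ≡ b
    spe-injective-on-canon {a = a} {b} a∈ b∈ eq = begin
      a       ≡⟨ ∈-map-canon⇒fixed a∈ ⟨
      canon a ≡⟨ PMatch⇒canon≡ (spe≡⇒PMatch eq) ⟩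
      canon b ≡⟨ ∈-map-canon⇒fixed b∈ ⟩
      b       ∎
      where open ≡-Reasoning

    spe-not-Prefix-of-shorter : ∀ {ws a b} → a ∈ map canon ws → b ∈ map canon ws →
      length a ≤ length b → a ≢ b → ¬ Prefix (spe b) (spe a)
    spe-not-Prefix-of-shorter {a = a} {b} a∈ b∈ |a|≤|b| a≢b spe-b⊑spe-a =
      a≢b (spe-injective-on-canon a∈ b∈ (sym (Prefix-of-shorter⇒≡ spe-b⊑spe-a |spe-a|≤|spe-b|)))
      where
        |spe-a|≤|spe-b| : length (spe a) ≤ length (spe b)
        |spe-a|≤|spe-b| = subst₂ _≤_ (PMatch⇒length≡ (PMatch-spe a)) (PMatch⇒length≡ (PMatch-spe b)) |a|≤|b|

lemma1 : (n : ℕ) (inΣ : Fin n → Bool) (spe : List (Fin n) → List (Fin n)) →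
    IsSpe n inΣ spe →
    (T : CST n) → ValidCST T →
    (P : CST n) → ValidCST P → (∀ x → (x ∈ W P) ⇔ (x ∈ pcs spe T)) →
    (ws : List (List (Fin n))) → Unique ws → (∀ x → (x ∈ ws) ⇔ (x ∈ pcs spe T)) →
    Linked (λ a b → length a ≤ length b) ws →
    NoPrefixEarlier (map spe ws) ×
    Σ (List (List (Fin n))) (λ nodes →
      (SHT (map spe ws) ≡ just nodes) × (length nodes ≡ nodeCount P) ×
      (length nodes ≡ length ws) × Unique nodes)
-- The root of T puts spe([])^R into pcs(T), so ws cannot be empty.
lemma1 n inΣ spe isSpe (node ks) _ P _ _ [] _ ws⇔pcs _
  with Equivalence.from (ws⇔pcs (reverse (spe []))) (here refl)
... | ()
lemma1 n inΣ spe isSpe T _ P P-valid P⇔pcs ws@(w ∷ ws′) ws! ws⇔pcs ws-sorted =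
  let nodes , sht≡ , |nodes|≡1+|ws′| , nodes! =
        shtSteps-just ([] ∷ []) (map spe ws′) ([] ∷ [])
          (All.map fresh-below-root (AllPairs.head later⋢earlier)) (AllPairs.tail later⋢earlier)
      |nodes|≡|ws| = trans |nodes|≡1+|ws′| (cong suc (length-map spe ws′))
  in AllPairs-lookup later⋢earlier , nodes , sht≡ , trans |nodes|≡|ws| (sym |P|≡|ws|) , |nodes|≡|ws| , nodes!
  where
    open PMatching n inΣ
    open Canonical spe isSpe

    later⋢earlier : AllPairs (λ s t → ¬ Prefix t s) (map spe ws)
    later⋢earlier = AllPairs.map⁺ (AllPairs-map-within
      (λ a∈ b∈ (|a|≤|b| , a≢b) → spe-not-Prefix-of-shorter a∈ b∈ |a|≤|b| a≢b)
      (All.tabulate (Equivalence.to (ws⇔pcs _)))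
      (AllPairs.zip (Linked⇒AllPairs ≤-trans ws-sorted , ws!)))

    fresh-below-root : ∀ {t} → ¬ Prefix t (spe w) → Fresh ([] ∷ []) t
    fresh-below-root t⋢w (here refl) t⊑[] = t⋢w (Prefix-trans t⊑[] (spe w , refl))

    |P|≡|ws| : nodeCount P ≡ length ws
    |P|≡|ws| = trans (nodeCount≡length-W P)
      (unique-set-equal⇒length≡ (W-unique P P-valid) ws! (⇔-sym (ws⇔pcs _) ⇔-∘ P⇔pcs _))
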